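{- Let $S \subset \mathbb{N}\times\mathbb{N}$ (where $\mathbb{N}=\{0,1,2,\dots\}$) be a set of steps with $(0,0)\notin S$, and let $a_{n,k}$ be the number of $S$-paths from $(0,0)$ to $(n,k)$, so that $$A(x,y)=\sum_{n,k\ge 0} a_{n,k}x^ny^k=\frac{1}{1-\sum_{(a,b)\in S}x^ay^b}.$$ Suppose that $$\sum_{(a,b)\in S}x^ay^b=\sum_{i=1}^r \alpha_i x^i + yx\sum_{j=0}^s \beta_j x^j,\qquad \beta_0\neq 0.$$ Then the matrix $(a_{n,k})_{n,k\ge 0}$ is a Riordan array.
   Context: An $S$-path from $(n_0,k_0)$ to $(n,k)$ is a finite sequence of steps $(a_1,b_1),\dots,(a_t,b_t)\in S$ with $(n_0+a_1+\cdots+a_t,\ k_0+b_1+\cdots+b_t)=(n,k)$. A Riordan array $(g(x),f(x))$ over a commutative ring $R$ (e.g. $\mathbb{Z},\mathbb{Q},\mathbb{R},\mathbb{C}$) is given by power series $g(x)=\sum_{n\ge0}g_nx^n$ with $g_0\neq0$ and $f(x)=\sum_{n\ge1}f_nx^n$ with $f_1\neq 0$; it is the lower-triangular matrix $(t_{n,k})_{n,k\ge0}$ with $t_{n,k}=[x^n]\,g(x)f(x)^k$, where $[x^n]$ extracts the coefficient of $x^n$. Its bivariate generating function is $\sum_{n,k}t_{n,k}x^ny^k=\frac{g(x)}{1-yf(x)}$. -}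

module Defs where

open import Data.Nat as ℕ using (ℕ; zero; suc; _≤_; _≤ᵇ_; _∸_)
open import Data.Integer as ℤ using (ℤ; +_)
open import Data.Bool using (Bool; true; false; if_then_else_; _∧_)
open import Data.Product using (Σ; _×_; _,_)
open import Data.List using (List; []; _∷_)
open import Data.List.Relation.Unary.All using (All)
open import Relation.Binary.PropositionalEquality using (_≡_)

StepSet : Set
StepSet = ℕ → ℕ → Bool

stepSum : List (ℕ × ℕ) → ℕ × ℕ
stepSum [] = (0 , 0)
stepSum ((a , b) ∷ l) with stepSum l
... | (n , k) = (a ℕ.+ n , b ℕ.+ k)

SPath : StepSet → ℕ → ℕ → Set
SPath S n k =
  Σ (List (ℕ × ℕ)) λ steps →
    All (λ st → S (Data.Product.proj₁ st) (Data.Product.proj₂ st) ≡ true) steps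
    × stepSum steps ≡ (n , k)

indicator : StepSet → ℕ → ℕ → ℤ
indicator S a b = if S a b then + 1 else + 0

-- Coefficient of x^a y^b in  Σ_{i=1}^r α_i x^i + y x Σ_{j=0}^s β_j x^j.
rhsCoeff : ℕ → (ℕ → ℤ) → ℕ → (ℕ → ℤ) → ℕ → ℕ → ℤ
rhsCoeff r α s β zero zero = + 0
rhsCoeff r α s β (suc a) zero = if suc a ≤ᵇ r then α (suc a) else + 0
rhsCoeff r α s β zero (suc zero) = + 0
rhsCoeff r α s β (suc a) (suc zero) = if a ≤ᵇ s then β a else + 0
rhsCoeff r α s β a (suc (suc b)) = + 0

PowerSeries : Set
PowerSeries = ℕ → ℤ

sumTo : ℕ → (ℕ → ℤ) → ℤ
sumTo zero h = h 0
sumTo (suc n) h = sumTo n h ℤ.+ h (suc n)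

_⊛_ : PowerSeries → PowerSeries → PowerSeries
(f ⊛ g) n = sumTo n (λ i → f i ℤ.* g (n ∸ i))

onePS : PowerSeries
onePS zero = + 1
onePS (suc n) = + 0

_^PS_ : PowerSeries → ℕ → PowerSeries
f ^PS zero = onePS
f ^PS suc k = f ⊛ (f ^PS k)

IsRiordanArrayOf : PowerSeries → PowerSeries → (ℕ → ℕ → ℤ) → Set
IsRiordanArrayOf g f t =
  (g 0 Relation.Binary.PropositionalEquality.≢ + 0)
  × (f 0 ≡ + 0)
  × (f 1 Relation.Binary.PropositionalEquality.≢ + 0)
  × (∀ n k → t n k ≡ (g ⊛ (f ^PS k)) n)

IsRiordanArray : (ℕ → ℕ → ℤ) → Set
IsRiordanArray t = Σ PowerSeries λ g → Σ PowerSeries λ f → IsRiordanArrayOf g f t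

{-# OPTIONS --safe #-}
module Submission where

-- Let P and Q be the generating series of the flat steps (a,0) and the rising steps (a,1)
-- of S. Removing the first step of a path, which has height 0 or 1, shows that the columns c_k
-- of the path-count matrix satisfy c_0 = P c_0 + 1 and c_{k+1} = P c_{k+1} + Q c_k. As P has no
-- constant term, each equation X = P X + h has exactly one solution. With g = c_0 and f = Q g,
-- the series g f^{k+1} solves the equation with h = f^{k+1} = Q (g f^k), so c_k = g f^k by
-- induction on k; moreover g_0 = 1, f_0 = Q_0 = 0 and f_1 = Q_1 = β_0 ≠ 0.

open import Defs
open import Data.Nat using (ℕ)
open import Data.Integer using (ℤ; +_)
open import Data.Bool using (false)
open import Data.Product using (Σ; _×_)
open import Data.Fin using (Fin)
open import Function.Bundles using (_↔_)
open import Relation.Binary.PropositionalEquality using (_≡_; _≢_)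

open import Data.Nat as ℕ using (zero; suc; _∸_; _≤_; _<_; z≤n; s≤s)
open import Data.Nat.Properties
  using (≤-refl; m≤n⇒m≤1+n; +-suc; n∸n≡0; +-∸-assoc; m+[n∸m]≡n; m+n∸m≡n; ∸-+-assoc; m∸n≤m)
import Data.Nat.Properties as ℕₚ
open import Data.Nat.Induction using (<-rec)
open import Data.Integer using (_+_; _*_)
open import Data.Integer.Properties
  using ( +-assoc; +-identityˡ; +-identityʳ; *-assoc; *-identityˡ; *-identityʳ; *-zeroˡ; *-zeroʳ
        ; *-distribˡ-+; *-distribʳ-+; +-commutativeSemigroup)
open import Algebra.Properties.CommutativeSemigroup +-commutativeSemigroup using (interchange)
open import Data.Bool using (Bool; true; if_then_else_)
open import Data.Bool.Properties using (not-¬)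
open import Data.Empty using (⊥; ⊥-elim)
open import Data.List using ([]; _∷_)
open import Data.List.Relation.Unary.All using ([]; _∷_)
open import Data.Product using (_,_; proj₂)
open import Data.Sum using (_⊎_; inj₁; inj₂)
open import Data.Sum.Function.Propositional using (_⊎-↔_)
open import Data.Fin.Properties using (+↔⊎)
open import Data.Fin.Permutation using (↔⇒≡)
open import Function.Bundles using (mk↔ₛ′)
open import Function.Properties.Inverse using (↔-sym; ↔-trans)
open import Relation.Binary.PropositionalEquality using (refl; sym; trans; cong; cong₂; subst)
open Relation.Binary.PropositionalEquality.≡-Reasoning
sumTo-cong : ∀ n {h h′ : ℕ → ℤ} → (∀ {i} → i ≤ n → h i ≡ h′ i) → sumTo n h ≡ sumTo n h′
sumTo-cong zero    eq = eq z≤n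
sumTo-cong (suc n) eq = cong₂ _+_ (sumTo-cong n (λ i≤n → eq (m≤n⇒m≤1+n i≤n))) (eq ≤-refl)

sumTo-zero : ∀ n {h : ℕ → ℤ} → (∀ {i} → i ≤ n → h i ≡ + 0) → sumTo n h ≡ + 0
sumTo-zero zero    eq = eq z≤n
sumTo-zero (suc n) eq = cong₂ _+_ (sumTo-zero n (λ i≤n → eq (m≤n⇒m≤1+n i≤n))) (eq ≤-refl)

sumTo-suc : ∀ n (h : ℕ → ℤ) → sumTo (suc n) h ≡ h 0 + sumTo n (λ i → h (suc i))
sumTo-suc zero    h = refl
sumTo-suc (suc n) h = trans (cong (_+ h (suc (suc n))) (sumTo-suc n h)) (+-assoc (h 0) _ _)

sumTo-distrib-+ : ∀ n (h h′ : ℕ → ℤ) → sumTo n (λ i → h i + h′ i) ≡ sumTo n h + sumTo n h′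
sumTo-distrib-+ zero    h h′ = refl
sumTo-distrib-+ (suc n) h h′ =
  trans (cong (_+ (h (suc n) + h′ (suc n))) (sumTo-distrib-+ n h h′))
        (interchange (sumTo n h) (sumTo n h′) (h (suc n)) (h′ (suc n)))

sumTo-distribˡ : ∀ n (x : ℤ) (h : ℕ → ℤ) → x * sumTo n h ≡ sumTo n (λ i → x * h i)
sumTo-distribˡ zero    x h = refl
sumTo-distribˡ (suc n) x h =
  trans (*-distribˡ-+ x (sumTo n h) (h (suc n))) (cong (_+ x * h (suc n)) (sumTo-distribˡ n x h))

sumTo-distribʳ : ∀ n (x : ℤ) (h : ℕ → ℤ) → sumTo n h * x ≡ sumTo n (λ i → h i * x)
sumTo-distribʳ zero    x h = refl
sumTo-distribʳ (suc n) x h =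
  trans (*-distribʳ-+ x (sumTo n h) (h (suc n))) (cong (_+ h (suc n) * x) (sumTo-distribʳ n x h))

sumTo-triangle : ∀ n (h : ℕ → ℕ → ℤ) →
  sumTo n (λ i → sumTo i (h i)) ≡ sumTo n (λ j → sumTo (n ∸ j) (λ l → h (j ℕ.+ l) j))
sumTo-triangle zero    h = refl
sumTo-triangle (suc n) h = begin
  sumTo n (λ i → sumTo i (h i)) + (sumTo n (h (suc n)) + h (suc n) (suc n))
    ≡⟨ cong (_+ (sumTo n (h (suc n)) + h (suc n) (suc n))) (sumTo-triangle n h) ⟩
  T n + (sumTo n (h (suc n)) + h (suc n) (suc n))
    ≡⟨ +-assoc (T n) _ _ ⟨
  (T n + sumTo n (h (suc n))) + h (suc n) (suc n)
    ≡⟨ cong₂ _+_ (sym (sumTo-distrib-+ n _ (h (suc n))))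
                 (cong (λ m → h m (suc n)) (sym (ℕₚ.+-identityʳ (suc n)))) ⟩
  sumTo n (λ j → T′ n j + h (suc n) j) + h (suc n ℕ.+ 0) (suc n)
    ≡⟨ cong₂ _+_ (sumTo-cong n (λ {j} → extend-row j))
                 (cong (λ m → sumTo m (λ l → h (suc n ℕ.+ l) (suc n))) (sym (n∸n≡0 n))) ⟩
  sumTo (suc n) (T′ (suc n)) ∎
  where
  T′ : ℕ → ℕ → ℤ
  T′ m j = sumTo (m ∸ j) (λ l → h (j ℕ.+ l) j)
  T : ℕ → ℤ
  T m = sumTo m (T′ m)
  extend-row : ∀ j → j ≤ n → T′ n j + h (suc n) j ≡ T′ (suc n) j
  extend-row j j≤n rewrite +-∸-assoc 1 j≤n =
    cong (λ m → T′ n j + h m j) (sym (trans (+-suc j (n ∸ j)) (cong suc (m+[n∸m]≡n j≤n))))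

⊛-congˡ : ∀ {A A′ : PowerSeries} (B : PowerSeries) → (∀ i → A i ≡ A′ i) → ∀ n → (A ⊛ B) n ≡ (A′ ⊛ B) n
⊛-congˡ B eq n = sumTo-cong n (λ {i} _ → cong (_* B (n ∸ i)) (eq i))

⊛-congʳ : ∀ (A : PowerSeries) {B B′ : PowerSeries} → (∀ i → B i ≡ B′ i) → ∀ n → (A ⊛ B) n ≡ (A ⊛ B′) n
⊛-congʳ A eq n = sumTo-cong n (λ {i} _ → cong (A i *_) (eq (n ∸ i)))

⊛-assoc : ∀ (A B C : PowerSeries) n → ((A ⊛ B) ⊛ C) n ≡ (A ⊛ (B ⊛ C)) n
⊛-assoc A B C n = begin
  sumTo n (λ i → sumTo i (λ j → A j * B (i ∸ j)) * C (n ∸ i))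
    ≡⟨ sumTo-cong n (λ {i} _ → sumTo-distribʳ i (C (n ∸ i)) _) ⟩
  sumTo n (λ i → sumTo i (λ j → A j * B (i ∸ j) * C (n ∸ i)))
    ≡⟨ sumTo-triangle n (λ i j → A j * B (i ∸ j) * C (n ∸ i)) ⟩
  sumTo n (λ j → sumTo (n ∸ j) (λ l → A j * B (j ℕ.+ l ∸ j) * C (n ∸ (j ℕ.+ l))))
    ≡⟨ sumTo-cong n (λ {j} _ → trans (sumTo-cong (n ∸ j) (λ {l} _ → reassociate j l))
                                     (sym (sumTo-distribˡ (n ∸ j) (A j) _))) ⟩
  sumTo n (λ j → A j * sumTo (n ∸ j) (λ l → B l * C (n ∸ j ∸ l))) ∎
  where
  reassociate : ∀ j l → A j * B (j ℕ.+ l ∸ j) * C (n ∸ (j ℕ.+ l)) ≡ A j * (B l * C (n ∸ j ∸ l))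
  reassociate j l rewrite m+n∸m≡n j l | sym (∸-+-assoc n j l) = *-assoc (A j) (B l) _

⊛-distribʳ-+ : ∀ (A B C : PowerSeries) n → ((λ i → A i + B i) ⊛ C) n ≡ (A ⊛ C) n + (B ⊛ C) n
⊛-distribʳ-+ A B C n =
  trans (sumTo-cong n (λ {i} _ → *-distribʳ-+ (C (n ∸ i)) (A i) (B i))) (sumTo-distrib-+ n _ _)

⊛-identityʳ : ∀ (A : PowerSeries) n → (A ⊛ onePS) n ≡ A n
⊛-identityʳ A zero    = *-identityʳ (A 0)
⊛-identityʳ A (suc n) = begin
  sumTo n (λ i → A i * onePS (suc n ∸ i)) + A (suc n) * onePS (suc n ∸ suc n)
    ≡⟨ cong₂ _+_ (sumTo-zero n off-diagonal) (cong (λ m → A (suc n) * onePS m) (n∸n≡0 n)) ⟩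
  + 0 + A (suc n) * + 1
    ≡⟨ trans (+-identityˡ _) (*-identityʳ (A (suc n))) ⟩
  A (suc n) ∎
  where
  off-diagonal : ∀ {i} → i ≤ n → A i * onePS (suc n ∸ i) ≡ + 0
  off-diagonal {i} i≤n rewrite +-∸-assoc 1 i≤n = *-zeroʳ (A i)

⊛-identityˡ : ∀ (A : PowerSeries) n → (onePS ⊛ A) n ≡ A n
⊛-identityˡ A zero    = *-identityˡ (A 0)
⊛-identityˡ A (suc n) = begin
  (onePS ⊛ A) (suc n)
    ≡⟨ sumTo-suc n _ ⟩
  + 1 * A (suc n) + sumTo n (λ i → + 0 * A (n ∸ i))
    ≡⟨ cong₂ _+_ (*-identityˡ (A (suc n))) (sumTo-zero n (λ {i} _ → *-zeroˡ (A (n ∸ i)))) ⟩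
  A (suc n) + + 0
    ≡⟨ +-identityʳ (A (suc n)) ⟩
  A (suc n) ∎

⊛-causal : ∀ (P : PowerSeries) {X Y : PowerSeries} → P 0 ≡ + 0 →
  ∀ n → (∀ {m} → m < n → X m ≡ Y m) → (P ⊛ X) n ≡ (P ⊛ Y) n
⊛-causal P {X} {Y} P₀≡0 n earlier = sumTo-cong n term
  where
  P₀-annihilates : ∀ x → P 0 * x ≡ + 0
  P₀-annihilates x = trans (cong (_* x) P₀≡0) (*-zeroˡ x)
  term : ∀ {i} → i ≤ n → P i * X (n ∸ i) ≡ P i * Y (n ∸ i)
  term {zero}  _       = trans (P₀-annihilates (X n)) (sym (P₀-annihilates (Y n)))
  term {suc i} (s≤s {n = m} i≤m) = cong (P (suc i) *_) (earlier (s≤s (m∸n≤m m i)))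

SolvesFixedPoint : PowerSeries → PowerSeries → PowerSeries → Set
SolvesFixedPoint P c X = ∀ n → X n ≡ (P ⊛ X) n + c n

fixedPoint-unique : ∀ (P : PowerSeries) {c X Y : PowerSeries} → P 0 ≡ + 0 →
  SolvesFixedPoint P c X → SolvesFixedPoint P c Y → ∀ n → X n ≡ Y n
fixedPoint-unique P {c} {X} {Y} P₀≡0 solX solY = <-rec (λ n → X n ≡ Y n) step
  where
  step : ∀ n → (∀ {m} → m < n → X m ≡ Y m) → X n ≡ Y n
  step n earlier = begin
    X n             ≡⟨ solX n ⟩
    (P ⊛ X) n + c n ≡⟨ cong (_+ c n) (⊛-causal P P₀≡0 n earlier) ⟩
    (P ⊛ Y) n + c n ≡⟨ sym (solY n) ⟩
    Y n             ∎

fixedPoint-⊛ : ∀ (P : PowerSeries) {g : PowerSeries} → SolvesFixedPoint P onePS g →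
  ∀ F → SolvesFixedPoint P F (g ⊛ F)
fixedPoint-⊛ P {g} solg F n = begin
  (g ⊛ F) n                               ≡⟨ ⊛-congˡ F solg n ⟩
  ((λ i → (P ⊛ g) i + onePS i) ⊛ F) n     ≡⟨ ⊛-distribʳ-+ (P ⊛ g) onePS F n ⟩
  ((P ⊛ g) ⊛ F) n + (onePS ⊛ F) n         ≡⟨ cong₂ _+_ (⊛-assoc P g F n) (⊛-identityˡ F n) ⟩
  (P ⊛ (g ⊛ F)) n + F n                   ∎

fixedPoint-head : ∀ (P : PowerSeries) {g : PowerSeries} → P 0 ≡ + 0 → SolvesFixedPoint P onePS g → g 0 ≡ + 1
fixedPoint-head P {g} P₀≡0 solg = begin
  g 0               ≡⟨ solg 0 ⟩
  P 0 * g 0 + + 1   ≡⟨ cong (λ p → p * g 0 + + 1) P₀≡0 ⟩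
  + 0 * g 0 + + 1   ≡⟨ cong (_+ + 1) (*-zeroˡ (g 0)) ⟩
  + 1               ∎

column : (ℕ → ℕ → ℤ) → ℕ → PowerSeries
column t k n = t n k

riordan-of-recurrence : ∀ (P Q : PowerSeries) (t : ℕ → ℕ → ℤ) →
  P 0 ≡ + 0 → Q 0 ≡ + 0 → Q 1 ≢ + 0 →
  SolvesFixedPoint P onePS (column t 0) →
  (∀ k → SolvesFixedPoint P (Q ⊛ column t k) (column t (suc k))) →
  IsRiordanArrayOf (column t 0) (Q ⊛ column t 0) t
riordan-of-recurrence P Q t P₀≡0 Q₀≡0 Q₁≢0 sol₀ sol₊ = g₀≢0 , f₀≡0 , f₁≢0 , columns
  where
  g f : PowerSeries
  g = column t 0
  f = Q ⊛ g
  g₀≡1 : g 0 ≡ + 1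
  g₀≡1 = fixedPoint-head P P₀≡0 sol₀
  g₀≢0 : g 0 ≢ + 0
  g₀≢0 g₀≡0 with trans (sym g₀≡1) g₀≡0
  ... | ()
  f₀≡0 : f 0 ≡ + 0
  f₀≡0 = trans (cong (_* g 0) Q₀≡0) (*-zeroˡ (g 0))
  f₁≡Q₁ : f 1 ≡ Q 1
  f₁≡Q₁ = begin
    Q 0 * g 1 + Q 1 * g 0 ≡⟨ cong₂ _+_ (trans (cong (_* g 1) Q₀≡0) (*-zeroˡ (g 1))) (cong (Q 1 *_) g₀≡1) ⟩
    + 0 + Q 1 * + 1       ≡⟨ trans (+-identityˡ _) (*-identityʳ (Q 1)) ⟩
    Q 1                   ∎
  f₁≢0 : f 1 ≢ + 0
  f₁≢0 f₁≡0 = Q₁≢0 (trans (sym f₁≡Q₁) f₁≡0)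
  columns : ∀ n k → t n k ≡ (g ⊛ (f ^PS k)) n
  columns n zero    = sym (⊛-identityʳ g n)
  columns n (suc k) = fixedPoint-unique P P₀≡0 (sol₊ k) solution n
    where
    solution : SolvesFixedPoint P (Q ⊛ column t k) (g ⊛ (f ^PS suc k))
    solution m = begin
      (g ⊛ (f ^PS suc k)) m                         ≡⟨ fixedPoint-⊛ P sol₀ (f ^PS suc k) m ⟩
      (P ⊛ (g ⊛ (f ^PS suc k))) m + (f ⊛ (f ^PS k)) m
        ≡⟨ cong (λ x → (P ⊛ (g ⊛ (f ^PS suc k))) m + x)
                (trans (⊛-assoc Q g (f ^PS k) m) (⊛-congʳ Q (λ i → sym (columns i k)) m)) ⟩
      (P ⊛ (g ⊛ (f ^PS suc k))) m + (Q ⊛ column t k) m ∎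

HasSize : Set → ℤ → Set
HasSize A z = Σ ℕ λ m → (z ≡ + m) × (Fin m ↔ A)

HasSize-unique : ∀ {A x y} → HasSize A x → HasSize A y → x ≡ y
HasSize-unique (m , x≡m , e) (m′ , y≡m′ , e′) =
  trans x≡m (trans (cong +_ (↔⇒≡ (↔-trans e (↔-sym e′)))) (sym y≡m′))

HasSize-↔ : ∀ {A B z} → A ↔ B → HasSize A z → HasSize B z
HasSize-↔ A↔B (m , z≡m , e) = m , z≡m , ↔-trans e A↔B

HasSize-⊎ : ∀ {A B x y} → HasSize A x → HasSize B y → HasSize (A ⊎ B) (x + y)
HasSize-⊎ (m , refl , e) (m′ , refl , e′) = m ℕ.+ m′ , refl , ↔-trans +↔⊎ (e ⊎-↔ e′)

HasSize-guard : ∀ {A z} (b : Bool) → HasSize A z → HasSize ((b ≡ true) × A) ((if b then + 1 else + 0) * z)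
HasSize-guard true  (m , refl , e) =
  m , *-identityˡ (+ m) , ↔-trans e (mk↔ₛ′ (refl ,_) proj₂ (λ { (refl , x) → refl }) (λ _ → refl))
HasSize-guard false (m , refl , e) = 0 , refl , mk↔ₛ′ (λ ()) (λ { (() , _) }) (λ { (() , _) }) (λ ())

HasSize-origin : ∀ n → HasSize (0 ≡ n) (onePS n)
HasSize-origin zero    =
  1 , refl , mk↔ₛ′ (λ _ → refl) (λ _ → Fin.zero) (λ { refl → refl }) (λ { Fin.zero → refl ; (Fin.suc ()) })
HasSize-origin (suc n) = 0 , refl , mk↔ₛ′ (λ ()) (λ ()) (λ ()) (λ ())

Split : ℕ → (ℕ → ℕ → Set) → Set
Split n R = Σ ℕ λ i → Σ ℕ λ m → (i ℕ.+ m ≡ n) × R i m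

Split-zero : ∀ {R} → Split 0 R ↔ R 0 0
Split-zero = mk↔ₛ′ (λ { (zero , zero , refl , r) → r }) (λ r → 0 , 0 , refl , r)
                   (λ _ → refl) (λ { (zero , zero , refl , r) → refl })

Split-suc : ∀ {n R} → Split (suc n) R ↔ (R 0 (suc n) ⊎ Split n (λ i → R (suc i)))
Split-suc {n} {R} = mk↔ₛ′ to from to∘from from∘to
  where
  to : Split (suc n) R → R 0 (suc n) ⊎ Split n (λ i → R (suc i))
  to (zero  , m , refl , r) = inj₁ r
  to (suc i , m , refl , r) = inj₂ (i , m , refl , r)
  from : R 0 (suc n) ⊎ Split n (λ i → R (suc i)) → Split (suc n) R
  from (inj₁ r)                  = 0 , suc n , refl , r
  from (inj₂ (i , m , refl , r)) = suc i , m , refl , r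
  to∘from : ∀ y → to (from y) ≡ y
  to∘from (inj₁ r)                  = refl
  to∘from (inj₂ (i , m , refl , r)) = refl
  from∘to : ∀ x → from (to x) ≡ x
  from∘to (zero  , m , refl , r) = refl
  from∘to (suc i , m , refl , r) = refl

HasSize-Split : ∀ {R : ℕ → ℕ → Set} {c : ℕ → ℕ → ℤ} → (∀ i m → HasSize (R i m) (c i m)) →
  ∀ n → HasSize (Split n R) (sumTo n (λ i → c i (n ∸ i)))
HasSize-Split size zero    = HasSize-↔ (↔-sym Split-zero) (size 0 0)
HasSize-Split {c = c} size (suc n) =
  subst (HasSize _) (sym (sumTo-suc n (λ i → c i (suc n ∸ i))))
    (HasSize-↔ (↔-sym Split-suc) (HasSize-⊎ (size 0 (suc n)) (HasSize-Split (λ i → size (suc i)) n)))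

flatSteps riseSteps : StepSet → PowerSeries
flatSteps S i = indicator S i 0
riseSteps S i = indicator S i 1

module _ (S : StepSet) where

  Flat NonFlat : ℕ → ℕ → Set
  Flat n k          = Split n (λ i m → (S i 0 ≡ true) × SPath S m k)
  NonFlat n zero    = 0 ≡ n
  NonFlat n (suc k) = Split n (λ i m → (S i 1 ≡ true) × SPath S m k)

  SPath-firstStep : (∀ a b → S a (suc (suc b)) ≡ false) → ∀ {n k} → SPath S n k ↔ (Flat n k ⊎ NonFlat n k)
  SPath-firstStep low = mk↔ₛ′ to (from _) (to∘from _) from∘to
    where
    too-steep : ∀ {a b} → S a (suc (suc b)) ≡ true → ⊥
    too-steep {a} {b} p = not-¬ p (low a b)
    to : ∀ {n k} → SPath S n k → Flat n k ⊎ NonFlat n k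
    to ([] , [] , refl)                        = inj₂ refl
    to (((i , 0) ∷ l) , p ∷ ps , refl)        = inj₁ (i , _ , refl , p , l , ps , refl)
    to (((i , 1) ∷ l) , p ∷ ps , refl)        = inj₂ (i , _ , refl , p , l , ps , refl)
    to (((i , suc (suc b)) ∷ l) , p ∷ ps , _) = ⊥-elim (too-steep p)
    from : ∀ {n} k → Flat n k ⊎ NonFlat n k → SPath S n k
    from k       (inj₁ (i , m , refl , p , l , ps , refl)) = ((i , 0) ∷ l) , p ∷ ps , refl
    from zero    (inj₂ refl)                                = [] , [] , refl
    from (suc k) (inj₂ (i , m , refl , p , l , ps , refl)) = ((i , 1) ∷ l) , p ∷ ps , refl
    to∘from : ∀ {n} k (y : Flat n k ⊎ NonFlat n k) → to (from k y) ≡ y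
    to∘from k       (inj₁ (i , m , refl , p , l , ps , refl)) = refl
    to∘from zero    (inj₂ refl)                                = refl
    to∘from (suc k) (inj₂ (i , m , refl , p , l , ps , refl)) = refl
    from∘to : ∀ {n k} (x : SPath S n k) → from k (to x) ≡ x
    from∘to ([] , [] , refl)                        = refl
    from∘to (((i , 0) ∷ l) , p ∷ ps , refl)        = refl
    from∘to (((i , 1) ∷ l) , p ∷ ps , refl)        = refl
    from∘to (((i , suc (suc b)) ∷ l) , p ∷ ps , _) = ⊥-elim (too-steep p)

  nonFlatCount : (ℕ → ℕ → ℤ) → ℕ → PowerSeries
  nonFlatCount t zero    = onePS
  nonFlatCount t (suc k) = riseSteps S ⊛ column t k

  module _ {t : ℕ → ℕ → ℤ} (size : ∀ n k → HasSize (SPath S n k) (t n k)) where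

    HasSize-Flat : ∀ n k → HasSize (Flat n k) ((flatSteps S ⊛ column t k) n)
    HasSize-Flat n k = HasSize-Split (λ i m → HasSize-guard (S i 0) (size m k)) n

    HasSize-NonFlat : ∀ n k → HasSize (NonFlat n k) (nonFlatCount t k n)
    HasSize-NonFlat n zero    = HasSize-origin n
    HasSize-NonFlat n (suc k) = HasSize-Split (λ i m → HasSize-guard (S i 1) (size m k)) n

    column-fixedPoint : (∀ a b → S a (suc (suc b)) ≡ false) →
      ∀ k → SolvesFixedPoint (flatSteps S) (nonFlatCount t k) (column t k)
    column-fixedPoint low k n = HasSize-unique (size n k)
      (HasSize-↔ (↔-sym (SPath-firstStep low)) (HasSize-⊎ (HasSize-Flat n k) (HasSize-NonFlat n k)))

indicator≡0⇒false : ∀ (b : Bool) → (if b then + 1 else + 0) ≡ + 0 → b ≡ false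
indicator≡0⇒false false _ = refl
indicator≡0⇒false true  ()

mainTheorem1 : (S : StepSet) → S 0 0 ≡ false →
    (r s : ℕ) (α β : ℕ → ℤ) →
    (∀ a b → indicator S a b ≡ rhsCoeff r α s β a b) →
    β 0 ≢ + 0 →
    (a : ℕ → ℕ → ℤ) →
    (∀ n k → Σ ℕ λ m → (a n k ≡ + m) × (Fin m ↔ SPath S n k)) →
    IsRiordanArray a
-- The hypothesis S 0 0 ≡ false is redundant: coeff 0 0 already gives flatSteps S 0 ≡ + 0.
mainTheorem1 S _ r s α β coeff β₀≢0 a size =
  column a 0 , riseSteps S ⊛ column a 0 ,
  riordan-of-recurrence (flatSteps S) (riseSteps S) a (coeff 0 0) (coeff 0 1) rise₁≢0
    (column-fixedPoint S size low 0) (λ k → column-fixedPoint S size low (suc k))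
  where
  -- rhsCoeff splits on its first argument before the second, hence the case split on i.
  low : ∀ i b → S i (suc (suc b)) ≡ false
  low zero    b = indicator≡0⇒false (S 0 (suc (suc b))) (coeff 0 (suc (suc b)))
  low (suc i) b = indicator≡0⇒false (S (suc i) (suc (suc b))) (coeff (suc i) (suc (suc b)))
  rise₁≢0 : riseSteps S 1 ≢ + 0
  rise₁≢0 rise₁≡0 = β₀≢0 (trans (sym (coeff 1 1)) rise₁≡0)
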